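{- Let $n\ge3$, let $m,y$ be nonnegative integers, and let $x$ be any position of Exco-Nim with parameter $n$ such that $m(x)=m$ and $y(x)=y$. Let $\mathcal{L}=\{(m(x'),y(x')) : x\to x'\text{ is a legal move}\}$. Then for every integer $v$ with $0\le v\le g(m,y)-1$ there exists $(m',y')\in\mathcal{L}$ with $g(m',y')=v$.
   Context: Exco-Nim with parameter $n$: positions are tuples $x=(x_0,x_1,\ldots,x_n)$ of nonnegative integers. A legal move $x\to x'$ is to a tuple $x'$ of nonnegative integers with $x'_j\le x_j$ for all $j$, $\sum_j x'_j<\sum_j x_j$, and $x'_i=x_i$ for at least one index $1\le i\le n$. For a position $x$: $m(x)=\min_{1\le i\le n}x_i$, $u(x)=\sum_{i=0}^n x_i$, $y(x)=u(x)-n\,m(x)$. For nonnegative integers $m,y$ put $u=y+nm$, $z=\binom{y+1}{2}+1$, and define $g(m,y)=u$ if $m<z$, and $g(m,y)=(z-1)+\big((m-z)\bmod(y+1)\big)$ if $m\ge z$, where $a\bmod b\in\{0,\ldots,b-1\}$. -}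

module Defs where

open import Data.Nat using (ℕ; zero; suc; _+_; _*_; _∸_; _≤_; _<_; _⊓_)
open import Data.Nat.DivMod using (_%_)
open import Data.Nat.Combinatorics using (_C_)
open import Data.Fin using (Fin; zero; suc)
open import Data.Product using (Σ; ∃; _×_)
open import Relation.Binary.PropositionalEquality using (_≡_)
open import Relation.Nullary using (Dec; yes; no)
open import Data.Nat using (_<?_)

-- A position of Exco-Nim with parameter n: x = (x₀, x₁, …, xₙ),
-- encoded as a function Fin (suc n) → ℕ; index zero is x₀ and
-- index suc i (i : Fin n) is x_{i+1}.
Position : ℕ → Set
Position n = Fin (suc n) → ℕ

sumFin : (k : ℕ) → (Fin k → ℕ) → ℕ
sumFin zero    f = 0
sumFin (suc k) f = f zero + sumFin k (λ i → f (suc i))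

minFin : (k : ℕ) → (Fin (suc k) → ℕ) → ℕ
minFin zero    f = f zero
minFin (suc k) f = f zero ⊓ minFin k (λ i → f (suc i))

mPos : (k : ℕ) → Position (suc k) → ℕ
mPos k x = minFin k (λ i → x (suc i))

uPos : (n : ℕ) → Position n → ℕ
uPos n x = sumFin (suc n) x

-- y(x) = u(x) - n m(x)   (never truncated since u(x) ≥ n m(x))
yPos : (k : ℕ) → Position (suc k) → ℕ
yPos k x = uPos (suc k) x ∸ suc k * mPos k x

LegalMove : (n : ℕ) → Position n → Position n → Set
LegalMove n x x' =
  ((j : Fin (suc n)) → x' j ≤ x j)
  × (uPos n x' < uPos n x)
  × (Σ (Fin n) λ i → x' (suc i) ≡ x (suc i))

zVal : ℕ → ℕ
zVal y = (suc y C 2) + 1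

g : (n m y : ℕ) → ℕ
g n m y with m <? zVal y
... | yes _ = y + n * m
... | no  _ = (zVal y ∸ 1) + ((m ∸ zVal y) % suc y)

module Submission where

-- Arithmetic and positions are separated by the notion of an option, the record
-- Lowering k m y m' y' (n = k + 1): the minimum drops by some d from m to m' = m - d,
-- and d ≤ y' ≤ y + k d, with y' < y when d = 0.
--  * option-values: every v < g(m, y) equals g(m', y') for an option (m', y').
--    Values v < m are hit in the periodic range of g, taking y' to be the triangular
--    root w of v (tri w ≤ v < tri w + w + 1) and the drop a residue modulo w + 1;
--    the remaining values lie in the linear range y + n m.
--  * Moves.realise: every option is (m(x'), y(x')) for a legal move x → x'.  A move is
--    obtained by squeezing x' between explicit lower and upper bound vectors with a
--    prescribed total (sumFin-between); lowering the minimum uses two heaps besides a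
--    minimal one, which is where n ≥ 3 enters.

open import Defs
open import Data.Empty using (⊥-elim)
open import Data.Fin using (Fin; zero; suc) renaming (_≟_ to _≟ᶠ_)
open import Data.Nat
open import Data.Nat.Properties
open import Data.Nat.DivMod
open import Data.Nat.Combinatorics using (_C_; nC1≡n; nCk+nC[k+1]≡[n+1]C[k+1])
open import Data.Nat.Tactic.RingSolver using (solve-∀)
open import Data.Product using (Σ; _×_; _,_; proj₁; proj₂)
open import Data.Sum using (_⊎_; inj₁; inj₂; [_,_]′)
open import Data.Vec.Functional using (updateAt; _∷_)
open import Data.Vec.Functional.Properties using (updateAt-updates; updateAt-minimal)
open import Function using (id; const; _∘_)
open import Relation.Binary using (tri<; tri≈; tri>)
open import Relation.Binary.PropositionalEquality
open import Relation.Nullary using (yes; no)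

-- Triangular numbers: tri w = (w+1 choose 2) = 1 + 2 + ⋯ + w, so zVal w = tri w + 1.
tri : ℕ → ℕ
tri w = suc w C 2

tri-suc : ∀ w → tri (suc w) ≡ suc w + tri w
tri-suc w = trans (sym (nCk+nC[k+1]≡[n+1]C[k+1] (suc w) 1)) (cong (_+ tri w) (nC1≡n (suc w)))

tri-mono : ∀ {w w'} → w ≤ w' → tri w ≤ tri w'
tri-mono {zero}  z≤n     = z≤n
tri-mono {suc w} {suc w'} (s≤s w≤w') =
  subst₂ _≤_ (sym (tri-suc w)) (sym (tri-suc w')) (+-mono-≤ (s≤s w≤w') (tri-mono w≤w'))

-- Consecutive triangular numbers differ by w + 1, so the intervals below tile ℕ.
tri-gap : ∀ {w w'} → w < w' → tri w + suc w ≤ tri w'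
tri-gap {w} w<w' = subst (_≤ _) (trans (tri-suc w) (+-comm (suc w) (tri w))) (tri-mono w<w')

tri-root : ∀ v → Σ ℕ λ w → tri w ≤ v × v < tri w + suc w
tri-root zero = 0 , z≤n , s≤s z≤n
tri-root (suc v) with tri-root v
... | w , lo , hi with m≤n⇒m<n∨m≡n hi
...   | inj₁ v+1<end = w , ≤-trans lo (n≤1+n v) , v+1<end
...   | inj₂ v+1≡end =
  suc w , ≤-reflexive tri≡ , subst (_< tri (suc w) + suc (suc w)) tri≡ (m<m+n _ z<s)
  where
  tri≡ : tri (suc w) ≡ suc v
  tri≡ = trans (tri-suc w) (trans (+-comm (suc w) (tri w)) (sym v+1≡end))

g-below : ∀ n m y → m < zVal y → g n m y ≡ y + n * m
g-below n m y m<z with m <? zVal y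
... | yes _   = refl
... | no  m≮z = ⊥-elim (m≮z m<z)

g-above : ∀ n m y → zVal y ≤ m → g n m y ≡ tri y + (m ∸ zVal y) % suc y
g-above n m y z≤m with m <? zVal y
... | yes m<z = ⊥-elim (<⇒≱ m<z z≤m)
... | no  _   = cong (_+ (m ∸ zVal y) % suc y) (m+n∸n≡m (tri y) 1)

-- Case analysis on the range, usable without unfolding g in other hypotheses.
g-cases : ∀ n m y → (m < zVal y × g n m y ≡ y + n * m)
                  ⊎ (zVal y ≤ m × g n m y ≡ tri y + (m ∸ zVal y) % suc y)
g-cases n m y with m <? zVal y
... | yes m<z = inj₁ (m<z , refl)
... | no  m≮z = inj₂ (≮⇒≥ m≮z , cong (_+ (m ∸ zVal y) % suc y) (m+n∸n≡m (tri y) 1))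

g-above-< : ∀ n m y → zVal y ≤ m → g n m y < m
g-above-< n m y z≤m = begin-strict
    g n m y
  ≡⟨ g-above n m y z≤m ⟩
    tri y + (m ∸ zVal y) % suc y
  ≤⟨ +-monoʳ-≤ (tri y) (m%n≤m (m ∸ zVal y) (suc y)) ⟩
    tri y + (m ∸ zVal y)
  <⟨ +-monoˡ-< (m ∸ zVal y) (m<m+n (tri y) z<s) ⟩
    zVal y + (m ∸ zVal y)
  ≡⟨ m+[n∸m]≡n z≤m ⟩
    m ∎
  where open ≤-Reasoning

residue-shift : ∀ a s N .{{_ : NonZero N}} → s ≤ a → s < N → (a ∸ (a ∸ s) % N) % N ≡ s
residue-shift a s N s≤a s<N = begin
    (a ∸ r) % N
  ≡⟨ cong (λ t → (t ∸ r) % N) (sym (m+[n∸m]≡n s≤a)) ⟩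
    (s + b ∸ r) % N
  ≡⟨ cong (_% N) (+-∸-assoc s (m%n≤m b N)) ⟩
    (s + (b ∸ r)) % N
  ≡⟨ cong (λ t → (s + t) % N) b∸r≡qN ⟩
    (s + (b / N) * N) % N
  ≡⟨ [m+kn]%n≡m%n s (b / N) N ⟩
    s % N
  ≡⟨ m<n⇒m%n≡m s<N ⟩
    s ∎
  where
  open ≡-Reasoning
  b r : ℕ
  b = a ∸ s
  r = b % N
  b∸r≡qN : b ∸ r ≡ (b / N) * N
  b∸r≡qN = trans (cong (_∸ r) (m≡m%n+[m/n]*n b N)) (m+n∸m≡n r _)

record Lowering (k m y m' y' : ℕ) : Set where
  constructor lowering
  field
    drop    : ℕ
    split   : m ≡ m' + drop
    drop≤y' : drop ≤ y'
    y'≤     : y' ≤ y + k * drop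
    keep    : drop ≡ 0 → y' < y

root-level : ∀ n m y v w → tri w ≤ v → v < m → v < g n m y
  → w < y ⊎ (w ≡ y × v < tri y + (m ∸ zVal y) % suc y)
root-level n m y v w lo v<m v<g with g-cases n m y
... | inj₁ (m<z , _) = inj₁ (≰⇒> λ y≤w → <⇒≱ (<-≤-trans v<m m≤tri) (≤-trans (tri-mono y≤w) lo))
  where
  m≤tri : m ≤ tri y
  m≤tri = s≤s⁻¹ (subst (m <_) (+-comm (tri y) 1) m<z)
... | inj₂ (_ , g≡) with <-cmp w y
...   | tri< w<y _ _ = inj₁ w<y
...   | tri≈ _ w≡y _ = inj₂ (w≡y , subst (v <_) g≡ v<g)
...   | tri> _ _ y<w = ⊥-elim (<⇒≱ v<end (≤-trans (tri-gap y<w) lo))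
  where
  v<end : v < tri y + suc y
  v<end = <-≤-trans (subst (v <_) g≡ v<g) (+-monoʳ-≤ (tri y) (<⇒≤ (m%n<n (m ∸ zVal y) (suc y))))

-- Values below m are reached periodically: with w the triangular root of v, lowering
-- the minimum by a suitable residue d ≤ w lands on g(m - d, w) = v.
periodic-values : ∀ k n m y v w → tri w ≤ v → v < tri w + suc w → v < m
  → (w < y ⊎ (w ≡ y × v < tri y + (m ∸ zVal y) % suc y))
  → Σ ℕ λ m' → Lowering k m y m' w × g n m' w ≡ v
periodic-values k n m y v w lo hi v<m level =
  m ∸ d , lowering d (sym (m∸n+n≡m d≤m)) d≤w (≤-trans w≤y (m≤m+n y (k * d))) keep , g≡v
  where
  s : ℕ
  s = v ∸ tri w
  s<w+1 : s < suc w
  s<w+1 = subst (s <_) (m+n∸m≡n (tri w) (suc w)) (∸-monoˡ-< hi lo)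
  s+z≤m : s + zVal w ≤ m
  s+z≤m = begin
      s + (tri w + 1)
    ≡⟨ sym (+-assoc s (tri w) 1) ⟩
      s + tri w + 1
    ≡⟨ cong (_+ 1) (m∸n+n≡m lo) ⟩
      v + 1
    ≡⟨ +-comm v 1 ⟩
      suc v
    ≤⟨ v<m ⟩
      m ∎
    where open ≤-Reasoning
  z≤m : zVal w ≤ m
  z≤m = ≤-trans (m≤n+m (zVal w) s) s+z≤m
  a : ℕ
  a = m ∸ zVal w
  s≤a : s ≤ a
  s≤a = m+n≤o⇒m≤o∸n s s+z≤m
  d : ℕ
  d = (a ∸ s) % suc w
  d≤a : d ≤ a
  d≤a = ≤-trans (m%n≤m (a ∸ s) (suc w)) (m∸n≤m a s)
  d≤m : d ≤ m
  d≤m = ≤-trans d≤a (m∸n≤m m (zVal w))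
  d≤w : d ≤ w
  d≤w = s≤s⁻¹ (m%n<n (a ∸ s) (suc w))
  m-d≡ : m ∸ d ≡ (a ∸ d) + zVal w
  m-d≡ = trans (cong (_∸ d) (sym (m∸n+n≡m z≤m))) (+-∸-comm (zVal w) d≤a)
  residue : (a ∸ d) % suc w ≡ s
  residue = residue-shift a s (suc w) s≤a s<w+1
  g≡v : g n (m ∸ d) w ≡ v
  g≡v = begin
      g n (m ∸ d) w
    ≡⟨ g-above n (m ∸ d) w (subst (zVal w ≤_) (sym m-d≡) (m≤n+m (zVal w) (a ∸ d))) ⟩
      tri w + (m ∸ d ∸ zVal w) % suc w
    ≡⟨ cong (λ t → tri w + (t ∸ zVal w) % suc w) m-d≡ ⟩
      tri w + ((a ∸ d) + zVal w ∸ zVal w) % suc w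
    ≡⟨ cong (λ t → tri w + t % suc w) (m+n∸n≡m (a ∸ d) (zVal w)) ⟩
      tri w + (a ∸ d) % suc w
    ≡⟨ cong (tri w +_) residue ⟩
      tri w + s
    ≡⟨ m+[n∸m]≡n lo ⟩
      v ∎
    where open ≡-Reasoning
  w≤y : w ≤ y
  w≤y = [ <⇒≤ , (λ (w≡y , _) → ≤-reflexive w≡y) ]′ level
  -- For w = y, a zero drop would make s the residue of a itself, which exceeds s.
  keep : d ≡ 0 → w < y
  keep d≡0 = [ id , (λ (w≡y , v<end) → ⊥-elim (<-irrefl a%≡s (s<a% w≡y v<end))) ]′ level
    where
    a%≡s : s ≡ a % suc w
    a%≡s = sym (trans (cong (λ t → (a ∸ t) % suc w) (sym d≡0)) residue)
    s<a% : w ≡ y → v < tri y + (m ∸ zVal y) % suc y → s < a % suc w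
    s<a% w≡y v<end = subst (s <_) (m+n∸m≡n (tri w) _)
      (∸-monoˡ-< (subst (λ t → v < tri t + (m ∸ zVal t) % suc t) (sym w≡y) v<end) lo)

g-zero : ∀ n v → g n 0 v ≡ v
g-zero n v = trans (g-below n 0 v (m≤n+m 1 (tri v)))
                   (trans (cong (v +_) (*-zeroʳ n)) (+-identityʳ v))

-- Values m ≤ v < y + n m (the linear range): either drop the minimum to 0 and take
-- y' = v, or, when v exceeds y + k m, keep t = v - (y + k m) as the new minimum.
linear-values : ∀ k → 1 ≤ k → ∀ m y v → m < zVal y → m ≤ v → v < y + suc k * m
  → Σ ℕ λ m' → Σ ℕ λ y' → Lowering k m y m' y' × g (suc k) m' y' ≡ v
linear-values k 1≤k m y v m<z m≤v v<g with v ≤? y + k * m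
... | yes v≤ = 0 , v , lowering m refl m≤v v≤ keep , g-zero (suc k) v
  where
  keep : m ≡ 0 → v < y
  keep refl = subst (v <_) (trans (cong (y +_) (*-zeroʳ k)) (+-identityʳ y)) v<g
... | no  v≰ = t , y + k * d , lowering d (sym (m+[n∸m]≡n (<⇒≤ t<m))) d≤y' ≤-refl keep , g≡v
  where
  K t d : ℕ
  K = y + k * m
  t = v ∸ K
  d = m ∸ t
  v≡K+t : v ≡ K + t
  v≡K+t = sym (m+[n∸m]≡n (<⇒≤ (≰⇒> v≰)))
  t<m : t < m
  t<m = +-cancelˡ-< K t m (subst₂ _<_ v≡K+t (regroup y k m) v<g)
    where
    regroup : ∀ y k m → y + suc k * m ≡ y + k * m + m
    regroup = solve-∀
  keep : d ≡ 0 → y + k * d < y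
  keep d≡0 = ⊥-elim (<⇒≢ (m<n⇒0<n∸m t<m) (sym d≡0))
  d≤y' : d ≤ y + k * d
  d≤y' = ≤-trans (subst (_≤ k * d) (*-identityˡ d) (*-monoˡ-≤ d 1≤k)) (m≤n+m (k * d) y)
  t<z : t < zVal (y + k * d)
  t<z = <-≤-trans t<m (≤-trans (<⇒≤ m<z) (+-monoˡ-≤ 1 (tri-mono (m≤m+n y (k * d)))))
  g≡v : g (suc k) t (y + k * d) ≡ v
  g≡v = begin
      g (suc k) t (y + k * d)
    ≡⟨ g-below (suc k) t (y + k * d) t<z ⟩
      y + k * d + suc k * t
    ≡⟨ regroup y k d t ⟩
      y + k * (t + d) + t
    ≡⟨ cong (λ e → y + k * e + t) (m+[n∸m]≡n (<⇒≤ t<m)) ⟩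
      K + t
    ≡⟨ sym v≡K+t ⟩
      v ∎
    where
    open ≡-Reasoning
    regroup : ∀ y k d t → y + k * d + suc k * t ≡ y + k * (t + d) + t
    regroup = solve-∀

option-values : ∀ k → 1 ≤ k → ∀ m y v → v < g (suc k) m y
  → Σ ℕ λ m' → Σ ℕ λ y' → Lowering k m y m' y' × g (suc k) m' y' ≡ v
option-values k 1≤k m y v v<g with v <? m
... | yes v<m = let (w , lo , hi) = tri-root v
                    (m' , option , g≡v) = periodic-values k (suc k) m y v w lo hi v<m
                                            (root-level (suc k) m y v w lo v<m v<g)
                in m' , w , option , g≡v
... | no  v≮m with g-cases (suc k) m y
...   | inj₁ (m<z , g≡) = linear-values k 1≤k m y v m<z (≮⇒≥ v≮m) (subst (v <_) g≡ v<g)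
...   | inj₂ (z≤m , _)  = ⊥-elim (v≮m (<-trans v<g (g-above-< (suc k) m y z≤m)))

minFin-lower : ∀ k (f : Fin (suc k) → ℕ) i → minFin k f ≤ f i
minFin-lower zero    f zero    = ≤-refl
minFin-lower (suc k) f zero    = m⊓n≤m _ _
minFin-lower (suc k) f (suc i) = ≤-trans (m⊓n≤n (f zero) _) (minFin-lower k (f ∘ suc) i)

minFin-greatest : ∀ k (f : Fin (suc k) → ℕ) c → (∀ i → c ≤ f i) → c ≤ minFin k f
minFin-greatest zero    f c c≤f = c≤f zero
minFin-greatest (suc k) f c c≤f = ⊓-glb (c≤f zero) (minFin-greatest k (f ∘ suc) c (c≤f ∘ suc))

minFin-attained : ∀ k (f : Fin (suc k) → ℕ) → Σ (Fin (suc k)) λ i → f i ≡ minFin k f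
minFin-attained zero    f = zero , refl
minFin-attained (suc k) f with minFin-attained k (f ∘ suc) | ⊓-sel (f zero) (minFin k (f ∘ suc))
... | _ , _   | inj₁ min≡head = zero , sym min≡head
... | i , f≡m | inj₂ min≡tail = suc i , trans f≡m (sym min≡tail)

minFin-≡ : ∀ k (f : Fin (suc k) → ℕ) c a → (∀ i → c ≤ f i) → f a ≤ c → minFin k f ≡ c
minFin-≡ k f c a c≤f fa≤c =
  ≤-antisym (≤-trans (minFin-lower k f a) fa≤c) (minFin-greatest k f c c≤f)

sumFin-mono : ∀ K (f h : Fin K → ℕ) → (∀ i → f i ≤ h i) → sumFin K f ≤ sumFin K h
sumFin-mono zero    f h f≤h = ≤-refl
sumFin-mono (suc K) f h f≤h = +-mono-≤ (f≤h zero) (sumFin-mono K (f ∘ suc) (h ∘ suc) (f≤h ∘ suc))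

sumFin-const : ∀ K c → sumFin K (const c) ≡ K * c
sumFin-const zero    c = refl
sumFin-const (suc K) c = cong (c +_) (sumFin-const K c)

sumFin-updateAt : ∀ K (h : Fin K → ℕ) p c
  → sumFin K (updateAt h p (const c)) + h p ≡ c + sumFin K h
sumFin-updateAt (suc K) h zero c = begin
    c + sumFin K (h ∘ suc) + h zero
  ≡⟨ +-assoc c _ (h zero) ⟩
    c + (sumFin K (h ∘ suc) + h zero)
  ≡⟨ cong (c +_) (+-comm _ (h zero)) ⟩
    c + sumFin (suc K) h ∎
  where open ≡-Reasoning
sumFin-updateAt (suc K) h (suc p) c = begin
    h zero + Σtail + h (suc p)
  ≡⟨ +-assoc (h zero) Σtail (h (suc p)) ⟩
    h zero + (Σtail + h (suc p))
  ≡⟨ cong (h zero +_) (sumFin-updateAt K (h ∘ suc) p c) ⟩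
    h zero + (c + sumFin K (h ∘ suc))
  ≡⟨ regroup (h zero) c (sumFin K (h ∘ suc)) ⟩
    c + sumFin (suc K) h ∎
  where
  open ≡-Reasoning
  Σtail : ℕ
  Σtail = sumFin K (updateAt (h ∘ suc) p (const c))
  regroup : ∀ a b e → a + (b + e) ≡ b + (a + e)
  regroup = solve-∀

updateAt-cases : ∀ {K} (P : ℕ → Set) (h : Fin K → ℕ) p c i
  → (i ≡ p → P c) → (i ≢ p → P (h i)) → P (updateAt h p (const c) i)
updateAt-cases P h p c i new old with i ≟ᶠ p
... | yes refl = subst P (sym (updateAt-updates p h)) (new refl)
... | no  i≢p  = subst P (sym (updateAt-minimal i p h i≢p)) (old i≢p)

updateAt-lower : ∀ {K} (h : Fin K → ℕ) p c → (∀ i → c ≤ h i) → ∀ i → c ≤ updateAt h p (const c) i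
updateAt-lower h p c c≤h i = updateAt-cases (c ≤_) h p c i (λ _ → ≤-refl) (λ _ → c≤h i)

sumFin-one-entry : ∀ K (h : Fin K → ℕ) c p → (∀ i → c ≤ h i) → h p + K * c ≤ sumFin K h + c
sumFin-one-entry K h c p c≤h = begin
    h p + K * c
  ≡⟨ cong (h p +_) (sym (sumFin-const K c)) ⟩
    h p + sumFin K (const c)
  ≤⟨ +-monoʳ-≤ (h p) (sumFin-mono K (const c) h' (updateAt-lower h p c c≤h)) ⟩
    h p + sumFin K h'
  ≡⟨ +-comm (h p) _ ⟩
    sumFin K h' + h p
  ≡⟨ sumFin-updateAt K h p c ⟩
    c + sumFin K h
  ≡⟨ +-comm c _ ⟩
    sumFin K h + c ∎
  where
  open ≤-Reasoning
  h' : Fin K → ℕ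
  h' = updateAt h p (const c)

-- Likewise two distinct entries together exceed c by at most Σ h - K c: apply the
-- one-entry bound to p after overwriting entry q by c.
sumFin-two-entries : ∀ K (h : Fin K → ℕ) c p q → p ≢ q → (∀ i → c ≤ h i)
  → h p + h q + K * c ≤ sumFin K h + (c + c)
sumFin-two-entries K h c p q p≢q c≤h = begin
    h p + h q + K * c
  ≡⟨ cong (λ e → e + h q + K * c) (sym (updateAt-minimal p q h p≢q)) ⟩
    h' p + h q + K * c
  ≡⟨ regroup₁ (h' p) (h q) (K * c) ⟩
    h q + (h' p + K * c)
  ≤⟨ +-monoʳ-≤ (h q) (sumFin-one-entry K h' c p (updateAt-lower h q c c≤h)) ⟩
    h q + (sumFin K h' + c)
  ≡⟨ regroup₂ (h q) (sumFin K h') c ⟩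
    (sumFin K h' + h q) + c
  ≡⟨ cong (_+ c) (sumFin-updateAt K h q c) ⟩
    c + sumFin K h + c
  ≡⟨ regroup₃ c (sumFin K h) ⟩
    sumFin K h + (c + c) ∎
  where
  open ≤-Reasoning
  h' : Fin K → ℕ
  h' = updateAt h q (const c)
  regroup₁ : ∀ a b e → a + b + e ≡ b + (a + e)
  regroup₁ = solve-∀
  regroup₂ : ∀ a b e → a + (b + e) ≡ (b + a) + e
  regroup₂ = solve-∀
  regroup₃ : ∀ a b → a + b + a ≡ b + (a + a)
  regroup₃ = solve-∀

sumFin-between : ∀ K (l b : Fin K → ℕ) S → (∀ i → l i ≤ b i) → sumFin K l ≤ S → S ≤ sumFin K b
  → Σ (Fin K → ℕ) λ f → (∀ i → l i ≤ f i) × (∀ i → f i ≤ b i) × sumFin K f ≡ S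
sumFin-between zero l b S l≤b Σl≤S S≤Σb = (λ ()) , (λ ()) , (λ ()) , sym (n≤0⇒n≡0 S≤Σb)
sumFin-between (suc K) l b S l≤b Σl≤S S≤Σb with S ≤? l zero + sumFin K (b ∘ suc)
-- Small total: keep the first entry at l zero and distribute S - l zero over the rest.
... | yes S≤ with sumFin-between K (l ∘ suc) (b ∘ suc) (S ∸ l zero) (l≤b ∘ suc) Σl'≤ ≤Σb'
  where
  Σl'≤ : sumFin K (l ∘ suc) ≤ S ∸ l zero
  Σl'≤ = m+n≤o⇒m≤o∸n _ (subst (_≤ S) (+-comm (l zero) _) Σl≤S)
  ≤Σb' : S ∸ l zero ≤ sumFin K (b ∘ suc)
  ≤Σb' = m≤n+o⇒m∸n≤o S (l zero) S≤
...   | f , l≤f , f≤b , Σf =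
  (l zero ∷ f)
  , (λ { zero → ≤-refl ; (suc i) → l≤f i })
  , (λ { zero → l≤b zero ; (suc i) → f≤b i })
  , trans (cong (l zero +_) Σf) (m+[n∸m]≡n (m+n≤o⇒m≤o (l zero) Σl≤S))
-- Large total: put the rest at its upper bound and let the first entry absorb the excess.
sumFin-between (suc K) l b S l≤b Σl≤S S≤Σb | no S≰ =
  (S ∸ Σb' ∷ b ∘ suc) , l≤f , f≤b , m∸n+n≡m Σb'≤S
  where
  Σb' : ℕ
  Σb' = sumFin K (b ∘ suc)
  l₀+Σb'<S : l zero + Σb' < S
  l₀+Σb'<S = ≰⇒> S≰
  Σb'≤S : Σb' ≤ S
  Σb'≤S = ≤-trans (m≤n+m Σb' (l zero)) (<⇒≤ l₀+Σb'<S)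
  l≤f : ∀ i → l i ≤ (S ∸ Σb' ∷ b ∘ suc) i
  l≤f zero    = m+n≤o⇒m≤o∸n (l zero) (<⇒≤ l₀+Σb'<S)
  l≤f (suc i) = l≤b (suc i)
  f≤b : ∀ i → (S ∸ Σb' ∷ b ∘ suc) i ≤ b i
  f≤b zero    = m≤n+o⇒m∸n≤o S Σb' (subst (S ≤_) (+-comm (b zero) Σb') S≤Σb)
  f≤b (suc i) = ≤-refl

two-others : ∀ {K} → 3 ≤ K → (i : Fin K) → Σ (Fin K) λ p → Σ (Fin K) λ q → p ≢ i × q ≢ i × p ≢ q
two-others (s≤s (s≤s (s≤s _))) zero          = suc zero , suc (suc zero) , (λ ()) , (λ ()) , (λ ())
two-others (s≤s (s≤s (s≤s _))) (suc zero)    = zero , suc (suc zero) , (λ ()) , (λ ()) , (λ ())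
two-others (s≤s (s≤s (s≤s _))) (suc (suc _)) = zero , suc zero , (λ ()) , (λ ()) , (λ ())

module Moves (k : ℕ) (x : Position (suc k)) where

  n : ℕ
  n = suc k

  inner : Fin n → ℕ
  inner i = x (suc i)

  m y u : ℕ
  m = mPos k x
  y = yPos k x
  u = uPos n x

  m≤inner : ∀ i → m ≤ inner i
  m≤inner = minFin-lower k inner

  u≡y+nm : u ≡ y + n * m
  u≡y+nm = sym (m∸n+n≡m (≤-trans nm≤Σ (m≤n+m _ (x zero))))
    where
    nm≤Σ : n * m ≤ sumFin n inner
    nm≤Σ = subst (_≤ sumFin n inner) (sumFin-const n m) (sumFin-mono n (const m) inner m≤inner)

  -- Lower bounds for a move keeping heap f and lowering the minimum to m',
  -- and upper bounds for a move pushing heap a down to m'.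
  floor : ℕ → Fin n → Fin n → ℕ
  floor m' f = updateAt (const m') f (const (inner f))

  ceiling : ℕ → Fin n → Fin n → ℕ
  ceiling m' a = updateAt inner a (const m')

  m'≤floor : ∀ m' f → (∀ i → m' ≤ inner i) → ∀ i → m' ≤ floor m' f i
  m'≤floor m' f m'≤ i = updateAt-cases (m' ≤_) (const m') f (inner f) i (λ _ → m'≤ f) (λ _ → ≤-refl)

  ceiling≤inner : ∀ m' a → (∀ i → m' ≤ inner i) → ∀ i → ceiling m' a i ≤ inner i
  ceiling≤inner m' a m'≤ i = updateAt-cases (_≤ inner i) inner a m' i (λ _ → m'≤ i) (λ _ → ≤-refl)

  floor≤ceiling : ∀ m' f a → (∀ i → m' ≤ inner i) → (f ≡ a → inner f ≤ m')
    → ∀ i → floor m' f i ≤ ceiling m' a i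
  floor≤ceiling m' f a m'≤ f≡a⇒ i = updateAt-cases (_≤ ceiling m' a i) (const m') f (inner f) i
    (λ i≡f → updateAt-cases (inner f ≤_) inner a m' i (λ i≡a → f≡a⇒ (trans (sym i≡f) i≡a))
                                                       (λ _ → ≤-reflexive (cong inner (sym i≡f))))
    (λ _ → updateAt-cases (m' ≤_) inner a m' i (λ _ → ≤-refl) (λ _ → m'≤ i))

  -- A move keeping heap f, with heap a reduced to the new minimum m' and new y-value y'.
  move-to : ∀ m' y' (f a : Fin n) → (∀ i → m' ≤ inner i) → (f ≡ a → inner f ≤ m')
    → inner f ≤ y' + m' → y' + n * m' + inner a ≤ u + m' → y' + n * m' < u
    → Σ (Position n) λ x' → LegalMove n x x' × mPos k x' ≡ m' × yPos k x' ≡ y'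
  move-to m' y' f a m'≤ f≡a⇒ f≤ a≤ S<u
    with sumFin-between (suc n) (0 ∷ floor m' f) (x zero ∷ ceiling m' a) (y' + n * m')
           (λ { zero → z≤n ; (suc i) → floor≤ceiling m' f a m'≤ f≡a⇒ i }) Σfloor≤S S≤Σceiling
    where
    S : ℕ
    S = y' + n * m'
    Σfloor≤S : sumFin n (floor m' f) ≤ S
    Σfloor≤S = +-cancelʳ-≤ m' _ S (begin
        sumFin n (floor m' f) + m'
      ≡⟨ sumFin-updateAt n (const m') f (inner f) ⟩
        inner f + sumFin n (const m')
      ≡⟨ cong (inner f +_) (sumFin-const n m') ⟩
        inner f + n * m'
      ≤⟨ +-monoˡ-≤ (n * m') f≤ ⟩
        y' + m' + n * m'
      ≡⟨ regroup y' m' (n * m') ⟩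
        S + m' ∎)
      where
      open ≤-Reasoning
      regroup : ∀ a b e → a + b + e ≡ a + e + b
      regroup = solve-∀
    S≤Σceiling : S ≤ x zero + sumFin n (ceiling m' a)
    S≤Σceiling = +-cancelʳ-≤ (inner a) S _ (begin
        S + inner a
      ≤⟨ a≤ ⟩
        x zero + sumFin n inner + m'
      ≡⟨ regroup (x zero) (sumFin n inner) m' ⟩
        x zero + (m' + sumFin n inner)
      ≡⟨ cong (x zero +_) (sym (sumFin-updateAt n inner a m')) ⟩
        x zero + (sumFin n (ceiling m' a) + inner a)
      ≡⟨ sym (+-assoc (x zero) _ (inner a)) ⟩
        x zero + sumFin n (ceiling m' a) + inner a ∎)
      where
      open ≤-Reasoning
      regroup : ∀ a b e → a + b + e ≡ a + (e + b)
      regroup = solve-∀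
  ... | x' , lo , hi , Σx' =
    x' , (x'≤x , subst (_< u) (sym Σx') S<u , f , keeps-f) , min≡m' , y≡y'
    where
    x'≤x : ∀ j → x' j ≤ x j
    x'≤x zero    = hi zero
    x'≤x (suc i) = ≤-trans (hi (suc i)) (ceiling≤inner m' a m'≤ i)
    keeps-f : x' (suc f) ≡ x (suc f)
    keeps-f = ≤-antisym (x'≤x (suc f))
                        (subst (_≤ x' (suc f)) (updateAt-updates f (const m')) (lo (suc f)))
    min≡m' : mPos k x' ≡ m'
    min≡m' = minFin-≡ k (x' ∘ suc) m' a (λ i → ≤-trans (m'≤floor m' f m'≤ i) (lo (suc i)))
                       (≤-trans (hi (suc a)) (≤-reflexive (updateAt-updates a inner)))
    y≡y' : yPos k x' ≡ y'
    y≡y' = trans (cong₂ (λ s t → s ∸ n * t) Σx' min≡m') (m+n∸n≡m y' (n * m'))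

  i₀ : Fin n
  i₀ = proj₁ (minFin-attained k inner)

  inner-i₀ : inner i₀ ≡ m
  inner-i₀ = proj₂ (minFin-attained k inner)

  keep-min : ∀ {m' y'} → m ≡ m' → y' < y
    → Σ (Position n) λ x' → LegalMove n x x' × mPos k x' ≡ m' × yPos k x' ≡ y'
  keep-min {y' = y'} refl y'<y =
    move-to m y' i₀ i₀ m≤inner (λ _ → ≤-reflexive inner-i₀)
            (≤-trans (≤-reflexive inner-i₀) (m≤n+m m y'))
            (subst (λ t → y' + n * m + t ≤ u + m) (sym inner-i₀) (+-monoˡ-≤ m (<⇒≤ S<u)))
            S<u
    where
    S<u : y' + n * m < u
    S<u = subst (y' + n * m <_) (sym u≡y+nm) (+-monoˡ-< (n * m) y'<y)

  above-lowered : ∀ {m' d} → m ≡ m' + d → 1 ≤ d → ∀ i → m' < inner i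
  above-lowered {m'} {d} split 1≤d i =
    ≤-trans (subst (_≤ m' + d) (+-comm m' 1) (+-monoʳ-≤ m' 1≤d))
            (subst (_≤ inner i) split (m≤inner i))

  lower-keeping-other : ∀ {m' y'} d p → m ≡ m' + d → 1 ≤ d → y' ≤ y + k * d → p ≢ i₀ → inner p ≤ y' + m'
    → Σ (Position n) λ x' → LegalMove n x x' × mPos k x' ≡ m' × yPos k x' ≡ y'
  lower-keeping-other {m'} {y'} d p split 1≤d y'≤ p≢i₀ p≤ =
    move-to m' y' p i₀ (<⇒≤ ∘ above-lowered split 1≤d) (⊥-elim ∘ p≢i₀) p≤ bound S<u
    where
    S : ℕ
    S = y' + n * m'
    bound : S + inner i₀ ≤ u + m'
    bound = begin
        S + inner i₀
      ≡⟨ cong (S +_) (trans inner-i₀ split) ⟩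
        y' + n * m' + (m' + d)
      ≤⟨ +-monoˡ-≤ (m' + d) (+-monoˡ-≤ (n * m') y'≤) ⟩
        y + k * d + n * m' + (m' + d)
      ≡⟨ regroup y k d m' ⟩
        y + n * (m' + d) + m'
      ≡⟨ cong (λ t → y + n * t + m') (sym split) ⟩
        y + n * m + m'
      ≡⟨ cong (_+ m') (sym u≡y+nm) ⟩
        u + m' ∎
      where
      open ≤-Reasoning
      regroup : ∀ y k d m' → y + k * d + suc k * m' + (m' + d) ≡ y + suc k * (m' + d) + m'
      regroup = solve-∀
    S<u : S < u
    S<u = +-cancelʳ-≤ m' (suc S) u (begin
        suc S + m'
      ≡⟨ sym (+-suc S m') ⟩
        S + suc m'
      ≤⟨ +-monoʳ-≤ S (above-lowered split 1≤d i₀) ⟩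
        S + inner i₀
      ≤⟨ bound ⟩
        u + m' ∎)
      where open ≤-Reasoning

  -- Lowering the minimum by d ≥ 1 when some heap p ≠ i₀ exceeds y' + m' (needs n ≥ 2):
  -- keep i₀ and push another heap q down to m'; heap p being large leaves room for this.
  lower-keeping-i₀ : 2 ≤ n → ∀ {m' y'} d p q → m ≡ m' + d → 1 ≤ d → d ≤ y' → p ≢ q → q ≢ i₀
    → y' + m' < inner p
    → Σ (Position n) λ x' → LegalMove n x x' × mPos k x' ≡ m' × yPos k x' ≡ y'
  lower-keeping-i₀ 2≤n {m'} {y'} d p q split 1≤d d≤y' p≢q q≢i₀ p-large =
    move-to m' y' i₀ q (<⇒≤ ∘ above-lowered split 1≤d) (⊥-elim ∘ q≢i₀ ∘ sym) i₀≤ (<⇒≤ bound) S<u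
    where
    S : ℕ
    S = y' + n * m'
    i₀≤ : inner i₀ ≤ y' + m'
    i₀≤ = subst (_≤ y' + m') (sym (trans inner-i₀ split))
                (subst (m' + d ≤_) (+-comm m' y') (+-monoʳ-≤ m' d≤y'))
    d+d≤nd : d + d ≤ n * d
    d+d≤nd = subst (_≤ n * d) (cong (d +_) (+-identityʳ d)) (*-monoˡ-≤ d 2≤n)
    -- Heaps p and q together exceed 2m by at most Σ inner - n m, and p > y' + m'.
    bound : S + inner q < u + m'
    bound = +-cancelʳ-≤ (m' + (d + d)) (suc (S + inner q)) (u + m') (begin
        suc (S + inner q) + (m' + (d + d))
      ≤⟨ +-monoʳ-≤ (suc (S + inner q)) (+-monoʳ-≤ m' d+d≤nd) ⟩
        suc (S + inner q) + (m' + n * d)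
      ≡⟨ regroup₁ y' k m' (inner q) d ⟩
        suc (y' + m') + inner q + n * (m' + d)
      ≤⟨ +-monoˡ-≤ (n * (m' + d)) (+-monoˡ-≤ (inner q) p-large) ⟩
        inner p + inner q + n * (m' + d)
      ≡⟨ cong (λ t → inner p + inner q + n * t) (sym split) ⟩
        inner p + inner q + n * m
      ≤⟨ sumFin-two-entries n inner m p q p≢q m≤inner ⟩
        sumFin n inner + (m + m)
      ≤⟨ +-monoˡ-≤ (m + m) (m≤n+m _ (x zero)) ⟩
        u + (m + m)
      ≡⟨ cong (λ t → u + (t + t)) split ⟩
        u + ((m' + d) + (m' + d))
      ≡⟨ regroup₂ u m' d ⟩
        u + m' + (m' + (d + d)) ∎)
      where
      open ≤-Reasoning
      regroup₁ : ∀ y' k m' c d → suc (y' + suc k * m' + c) + (m' + suc k * d)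
                                 ≡ suc (y' + m') + c + suc k * (m' + d)
      regroup₁ = solve-∀
      regroup₂ : ∀ u m' d → u + ((m' + d) + (m' + d)) ≡ u + m' + (m' + (d + d))
      regroup₂ = solve-∀
    S<u : S < u
    S<u = +-cancelʳ-≤ m' (suc S) u
            (≤-trans (+-monoʳ-≤ (suc S) (<⇒≤ (above-lowered split 1≤d q))) bound)

  -- Lowering the minimum by d ≥ 1 (n ≥ 3): choose heaps p, q distinct from each other and
  -- from i₀, and keep p if it fits into the new total, otherwise keep i₀.
  lower-min : 3 ≤ n → ∀ {m' y'} d → m ≡ m' + d → 1 ≤ d → d ≤ y' → y' ≤ y + k * d
    → Σ (Position n) λ x' → LegalMove n x x' × mPos k x' ≡ m' × yPos k x' ≡ y'
  lower-min 3≤n {m'} {y'} d split 1≤d d≤y' y'≤ with two-others 3≤n i₀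
  ... | p , q , p≢i₀ , q≢i₀ , p≢q with inner p ≤? y' + m'
  ...   | yes p≤ = lower-keeping-other d p split 1≤d y'≤ p≢i₀ p≤
  ...   | no  p≰ =
    lower-keeping-i₀ (≤-trans (n≤1+n 2) 3≤n) d p q split 1≤d d≤y' p≢q q≢i₀ (≰⇒> p≰)

  realise : 3 ≤ n → ∀ {m' y'} → Lowering k m y m' y'
    → Σ (Position n) λ x' → LegalMove n x x' × mPos k x' ≡ m' × yPos k x' ≡ y'
  realise _   (lowering zero    split _ _ keep) = keep-min (trans split (+-identityʳ _)) (keep refl)
  realise 3≤n (lowering (suc d) split d≤y' y'≤ _) = lower-min 3≤n (suc d) split (s≤s z≤n) d≤y' y'≤

lemma3p7 : (k : ℕ) → 3 ≤ suc k → (m y : ℕ) → (x : Position (suc k))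
    → mPos k x ≡ m → yPos k x ≡ y
    → (v : ℕ) → v < g (suc k) m y
    → Σ (Position (suc k)) λ x' → LegalMove (suc k) x x' × g (suc k) (mPos k x') (yPos k x') ≡ v
lemma3p7 k 3≤n m y x refl refl v v<g =
  let (m' , y' , option , g≡v)    = option-values k 1≤k m y v v<g
      (x' , move , min≡m' , y≡y') = Moves.realise k x 3≤n option
  in x' , move , trans (cong₂ (g (suc k)) min≡m' y≡y') g≡v
  where
  1≤k : 1 ≤ k
  1≤k = ≤-trans (s≤s z≤n) (s≤s⁻¹ 3≤n)
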